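{- Consider the Game of Cards with $p$ players and $n$ cards, and let $O$ be a configuration. Let $a$ and $b$ be two non-dual configurations reachable from $O$. Then $b$ is reachable from $a$ with $b\neq a$ if and only if $s(O,a)<s(O,b)$, where $<$ denotes the componentwise order on $\mathbb Z^p$ ($x<y$ iff $x_i\le y_i$ for all $i$ and $x\neq y$).
   Context: Game of Cards: $p$ players sit in a cycle; indices are taken modulo $p$ (player $p$'s right neighbor is player $1$). A configuration is a vector $(a_1,\dots,a_p)$ of nonnegative integers with sum $n$. A move at position $i$ is allowed in $a$ iff $a_i>a_{i+1}$ (with $a_{p+1}=a_1$); it replaces $a_i$ by $a_i-1$ and $a_{i+1}$ by $a_{i+1}+1$. Reachability means existence of a finite sequence of moves. Let $\mathcal G$ be the directed graph on configurations with an arc $a\to b$ whenever $b$ is obtained from $a$ by one move; a configuration is dual if it lies on a directed cycle of positive length in $\mathcal G$, non-dual otherwise. The shot vector of a sequence of moves is the vector whose $i$-th entry is the number of moves at position $i$. For a non-dual configuration $a$ reachable from $O$, $s(O,a)$ denotes the shot vector of any sequence of moves from $O$ to $a$ (all such sequences have the same shot vector). -}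

module Defs where

open import Data.Nat using (ℕ; zero; suc; _+_; _∸_; _≤_; _<_; NonZero)
open import Data.Nat.DivMod using (_%_; m%n<n)
open import Data.Fin using (Fin; toℕ; fromℕ<; _≟_)
open import Data.Vec.Functional using (foldr)
open import Data.Product using (Σ; _×_)
open import Relation.Nullary using (¬_; yes; no)

Config : ℕ → Set
Config p = Fin p → ℕ

total : ∀ {p} → Config p → ℕ
total a = foldr _+_ 0 a

next : ∀ {p} .{{_ : NonZero p}} → Fin p → Fin p
next {p} i = fromℕ< (m%n<n (suc (toℕ i)) p)

fire : ∀ {p} .{{_ : NonZero p}} → Config p → Fin p → Config p
fire a i j with j ≟ i
... | yes _ = a j ∸ 1
... | no _ with j ≟ next i
...   | yes _ = suc (a j)
...   | no _ = a j

Allowed : ∀ {p} .{{_ : NonZero p}} → Config p → Fin p → Set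
Allowed a i = a (next i) < a i

_≈ᶜ_ : ∀ {p} → Config p → Config p → Set
a ≈ᶜ b = ∀ j → a j ≡ b j
  where open import Relation.Binary.PropositionalEquality using (_≡_)

data Moves {p} .{{_ : NonZero p}} : Config p → Config p → Set where
  done : ∀ {a b} → a ≈ᶜ b → Moves a b
  step : ∀ {a c} (i : Fin p) → Allowed a i → Moves (fire a i) c → Moves a c

len : ∀ {p} .{{_ : NonZero p}} {a b : Config p} → Moves a b → ℕ
len (done _) = 0
len (step _ _ σ) = suc (len σ)

shots : ∀ {p} .{{_ : NonZero p}} {a b : Config p} → Moves a b → Fin p → ℕ
shots (done _) k = 0
shots (step i _ σ) k with k ≟ i
... | yes _ = suc (shots σ k)
... | no _ = shots σ k

Reachable : ∀ {p} .{{_ : NonZero p}} → Config p → Config p → Set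
Reachable a b = Moves a b

Dual : ∀ {p} .{{_ : NonZero p}} → Config p → Set
Dual a = Σ (Moves a a) (λ σ → 0 < len σ)

NonDual : ∀ {p} .{{_ : NonZero p}} → Config p → Set
NonDual a = ¬ Dual a

_<ᶜ_ : ∀ {p} → (Fin p → ℕ) → (Fin p → ℕ) → Set
x <ᶜ y = (∀ i → x i ≤ y i) × ¬ (x ≈ᶜ y)

module Submission where

-- Firing shot vector u from O yields the configuration x with
-- x (j+1) = O (j+1) + u j − u (j+1); so the end configuration of a move sequence
-- depends only on its shot vector, and two shot vectors reaching the same
-- configuration differ by a constant, hence are comparable. If u ≤ shots π for a
-- move sequence π from O, the moves of π beyond u can still be played from the
-- configuration u yields. At a non-dual configuration every cycle is empty, so
-- comparable shot vectors reaching it coincide; both directions of the theorem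
-- follow from this uniqueness and the replay of remaining moves.

open import Defs
open import Data.Nat using (ℕ; NonZero; zero; suc; _+_; _∸_; _≤_; _<_; z≤n; s≤s) renaming (_≟_ to _≟ℕ_)
open import Data.Nat.Properties hiding (_≟_)
open import Data.Nat.DivMod using (_%_; m<n⇒m%n≡m; n%n≡0)
open import Data.Fin using (Fin; toℕ; fromℕ<; fromℕ; inject₁; _≟_)
import Data.Fin as Fin
open import Data.Fin.Properties using (toℕ-injective; toℕ-fromℕ<; toℕ-fromℕ; toℕ-inject₁; toℕ<n; fromℕ<-toℕ)
open import Data.Product using (_×_; Σ; ∃; _,_; proj₁; proj₂)
open import Data.Sum using (_⊎_; inj₁; inj₂)
open import Data.Empty using (⊥-elim)
open import Relation.Nullary using (¬_; Dec; yes; no)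
open import Relation.Binary.PropositionalEquality
  using (_≡_; _≢_; refl; sym; trans; cong; cong₂; subst; subst₂; module ≡-Reasoning)
open import Function.Bundles using (_⇔_; mk⇔)
open import Algebra.Properties.CommutativeSemigroup +-commutativeSemigroup
  using (x∙yz≈xz∙y; xy∙z≈xz∙y; xy∙z≈x∙zy)

module _ {q : ℕ} where

  next-cases : (i : Fin (suc q)) →
    (toℕ i ≡ q × toℕ (next i) ≡ 0) ⊎ (suc (toℕ i) < suc q × toℕ (next i) ≡ suc (toℕ i))
  next-cases i with suc (toℕ i) <? suc q
  ... | yes lt = inj₂ (lt , trans (toℕ-fromℕ< _) (m<n⇒m%n≡m lt))
  ... | no ¬lt = inj₁ (i≡q , trans (toℕ-fromℕ< _) (trans (cong (λ m → suc m % suc q) i≡q) (n%n≡0 (suc q))))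
    where
    i≡q : toℕ i ≡ q
    i≡q with m≤n⇒m<n∨m≡n (≤-pred (toℕ<n i))
    ... | inj₁ lt = ⊥-elim (¬lt (s≤s lt))
    ... | inj₂ eq = eq

  next-induction : (P : Fin (suc q) → Set) → P Fin.zero → (∀ j → P j → P (next j)) → ∀ j → P j
  next-induction P P0 Pnext j = subst P (fromℕ<-toℕ j (toℕ<n j)) (go (toℕ j) (toℕ<n j))
    where
    go : ∀ k (k<1+q : k < suc q) → P (fromℕ< k<1+q)
    go zero _ = P0
    go (suc k) k+1<1+q = subst P next-k≡k+1 (Pnext _ (go k k<1+q))
      where
      k<1+q : k < suc q
      k<1+q = <-trans (n<1+n k) k+1<1+q
      next-k≡k+1 : next (fromℕ< k<1+q) ≡ fromℕ< k+1<1+q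
      next-k≡k+1 with next-cases (fromℕ< k<1+q)
      ... | inj₁ (k≡q , _) = ⊥-elim (<-irrefl (cong suc (trans (sym (toℕ-fromℕ< _)) k≡q)) k+1<1+q)
      ... | inj₂ (_ , eq) = toℕ-injective (trans eq (trans (cong suc (toℕ-fromℕ< _)) (sym (toℕ-fromℕ< k+1<1+q))))

next-injective : ∀ {p} .{{_ : NonZero p}} (i j : Fin p) → next i ≡ next j → i ≡ j
next-injective {suc q} i j e with next-cases i | next-cases j
... | inj₁ (i≡q , _) | inj₁ (j≡q , _) = toℕ-injective (trans i≡q (sym j≡q))
... | inj₁ (_ , a) | inj₂ (_ , b) with () ← trans (sym a) (trans (cong toℕ e) b)
... | inj₂ (_ , a) | inj₁ (_ , b) with () ← trans (sym a) (trans (cong toℕ e) b)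
... | inj₂ (_ , a) | inj₂ (_ , b) = toℕ-injective (suc-injective (trans (sym a) (trans (cong toℕ e) b)))

next-surjective : ∀ {p} .{{_ : NonZero p}} (j : Fin p) → ∃ λ i → next i ≡ j
next-surjective {suc q} Fin.zero with next-cases (fromℕ q)
... | inj₁ (_ , last↦0) = fromℕ q , toℕ-injective last↦0
... | inj₂ (lt , _) = ⊥-elim (<-irrefl (cong suc (toℕ-fromℕ q)) lt)
next-surjective {suc q} (Fin.suc j) with next-cases (inject₁ j)
... | inj₁ (j≡q , _) = ⊥-elim (<-irrefl (trans (sym (toℕ-inject₁ j)) j≡q) (toℕ<n j))
... | inj₂ (_ , eq) = inject₁ j , toℕ-injective (trans eq (cong suc (toℕ-inject₁ j)))

-- s − s' is constant along the cycle.
Parallel : ∀ {p} .{{_ : NonZero p}} → (Fin p → ℕ) → (Fin p → ℕ) → Set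
Parallel s s' = ∀ j → s (next j) + s' j ≡ s' (next j) + s j

_≤ᶜ_ : ∀ {p} → (Fin p → ℕ) → (Fin p → ℕ) → Set
s ≤ᶜ s' = ∀ j → s j ≤ s' j

parallel-≤-next : ∀ {p} .{{_ : NonZero p}} {s s' : Fin p → ℕ} → Parallel s s' →
                  ∀ j → s j ≤ s' j → s (next j) ≤ s' (next j)
parallel-≤-next {s = s} par j le =
  +-cancelʳ-≤ (s j) _ _ (≤-trans (+-monoʳ-≤ (s (next j)) le) (≤-reflexive (par j)))

parallel-comparable : ∀ {p} .{{_ : NonZero p}} {s s' : Fin p → ℕ} → Parallel s s' → s ≤ᶜ s' ⊎ s' ≤ᶜ s
parallel-comparable {suc q} {s} {s'} par with s Fin.zero ≤? s' Fin.zero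
... | yes le = inj₁ (next-induction _ le (parallel-≤-next par))
... | no ¬le = inj₂ (next-induction _ (≰⇒≥ ¬le) (parallel-≤-next (λ j → sym (par j))))

module _ {p : ℕ} .{{_ : NonZero p}} where

  infixl 30 _⊕_
  _⊕_ : (Fin p → ℕ) → (Fin p → ℕ) → Fin p → ℕ
  (u ⊕ v) k = u k + v k

  infixl 30 _⊖_
  _⊖_ : (Fin p → ℕ) → (Fin p → ℕ) → Fin p → ℕ
  (u ⊖ v) k = u k ∸ v k

  ⊖-⊕-inverse : ∀ {u v} → v ≤ᶜ u → u ⊖ v ⊕ v ≈ᶜ u
  ⊖-⊕-inverse v≤u k = m∸n+n≡m (v≤u k)

  ⊖-≤-from-⊕ : ∀ {u v w} → u ≤ᶜ v ⊕ w → u ⊖ w ≤ᶜ v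
  ⊖-≤-from-⊕ {v = v} {w} u≤v+w k = subst (_ ≤_) (m+n∸n≡m (v k) (w k)) (∸-monoˡ-≤ (w k) (u≤v+w k))

  ⊕-identityʳ-≈ : ∀ {u v w} → u ⊕ v ≈ᶜ w → v ≈ᶜ (λ _ → 0) → u ≈ᶜ w
  ⊕-identityʳ-≈ {u} u+v≈w v≈0 k = trans (sym (trans (cong (u k +_) (v≈0 k)) (+-identityʳ _))) (u+v≈w k)

  δ : Fin p → Fin p → ℕ
  δ i k with k ≟ i
  ... | yes _ = 1
  ... | no _ = 0

  δ-diag : ∀ i → δ i i ≡ 1
  δ-diag i with i ≟ i
  ... | yes _ = refl
  ... | no i≢i = ⊥-elim (i≢i refl)

  δ-off : ∀ {i k} → k ≢ i → δ i k ≡ 0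
  δ-off {i} {k} k≢i with k ≟ i
  ... | yes k≡i = ⊥-elim (k≢i k≡i)
  ... | no _ = refl

  δ-≤ : ∀ {u i} → u i ≢ 0 → δ i ≤ᶜ u
  δ-≤ {u} {i} uᵢ≢0 k with k ≟ i
  ... | yes refl = n≢0⇒n>0 uᵢ≢0
  ... | no _ = z≤n

  ≤-⊕δ-at-zero : ∀ {u v i} → u ≤ᶜ v ⊕ δ i → u i ≡ 0 → u ≤ᶜ v
  ≤-⊕δ-at-zero {u} {v} {i} u≤v+δ uᵢ≡0 k with k ≟ i
  ... | yes refl = subst (_≤ v k) (sym uᵢ≡0) z≤n
  ... | no k≢i = subst (u k ≤_) (trans (cong (v k +_) (δ-off k≢i)) (+-identityʳ _)) (u≤v+δ k)

  fire-self : ∀ (a : Config p) i → fire a i i ≡ a i ∸ 1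
  fire-self a i with i ≟ i
  ... | yes _ = refl
  ... | no i≢i = ⊥-elim (i≢i refl)

  fire-next : ∀ (a : Config p) i → next i ≢ i → fire a i (next i) ≡ suc (a (next i))
  fire-next a i ni≢i with next i ≟ i
  ... | yes ni≡i = ⊥-elim (ni≢i ni≡i)
  ... | no _ with next i ≟ next i
  ...   | yes _ = refl
  ...   | no ni≢ni = ⊥-elim (ni≢ni refl)

  fire-other : ∀ (a : Config p) {i k} → k ≢ i → k ≢ next i → fire a i k ≡ a k
  fire-other a {i} {k} k≢i k≢ni with k ≟ i
  ... | yes k≡i = ⊥-elim (k≢i k≡i)
  ... | no _ with k ≟ next i
  ...   | yes k≡ni = ⊥-elim (k≢ni k≡ni)
  ...   | no _ = refl

  fire-cong : ∀ {a b : Config p} → a ≈ᶜ b → ∀ i → fire a i ≈ᶜ fire b i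
  fire-cong a≈b i k with k ≟ i
  ... | yes _ = cong (_∸ 1) (a≈b k)
  ... | no _ with k ≟ next i
  ...   | yes _ = cong suc (a≈b k)
  ...   | no _ = a≈b k

  shots-step : ∀ {a c} i (al : Allowed a i) (π : Moves (fire a i) c) → shots (step i al π) ≈ᶜ shots π ⊕ δ i
  shots-step i al π k with k ≟ i
  ... | yes _ = +-comm 1 (shots π k)
  ... | no _ = sym (+-identityʳ _)

  -- The card balance of letting each player k fire u k times from O, ending in x:
  -- player next j receives u j cards and gives away u (next j).
  record Fires (O : Config p) (u : Fin p → ℕ) (x : Config p) : Set where
    field balance : ∀ j → x (next j) + u (next j) ≡ O (next j) + u j
  open Fires

  fires-resp : ∀ {O x u v} → u ≈ᶜ v → Fires O u x → Fires O v x
  balance (fires-resp {O} {x} u≈v fu) j =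
    subst₂ (λ a b → x (next j) + a ≡ O (next j) + b) (u≈v (next j)) (u≈v j) (balance fu j)

  fires-trans : ∀ {O a b s r} → Fires O s a → Fires a r b → Fires O (s ⊕ r) b
  balance (fires-trans {O} {a} {b} {s} {r} fs fr) j = begin
    b (next j) + (s (next j) + r (next j))  ≡⟨ x∙yz≈xz∙y (b (next j)) _ _ ⟩
    (b (next j) + r (next j)) + s (next j)  ≡⟨ cong (_+ s (next j)) (balance fr j) ⟩
    (a (next j) + r j) + s (next j)         ≡⟨ xy∙z≈xz∙y (a (next j)) _ _ ⟩
    (a (next j) + s (next j)) + r j         ≡⟨ cong (_+ r j) (balance fs j) ⟩
    (O (next j) + s j) + r j                ≡⟨ +-assoc (O (next j)) _ _ ⟩
    O (next j) + (s j + r j)                ∎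
    where open ≡-Reasoning

  fires-cancel : ∀ {O a b s r} → Fires O s a → Fires O (s ⊕ r) b → Fires a r b
  balance (fires-cancel {O} {a} {b} {s} {r} fs fsr) j = +-cancelʳ-≡ (s (next j)) _ _ (begin
    (b (next j) + r (next j)) + s (next j)  ≡⟨ xy∙z≈x∙zy (b (next j)) _ _ ⟩
    b (next j) + (s (next j) + r (next j))  ≡⟨ balance fsr j ⟩
    O (next j) + (s j + r j)                ≡⟨ +-assoc (O (next j)) _ _ ⟨
    (O (next j) + s j) + r j                ≡⟨ cong (_+ r j) (balance fs j) ⟨
    (a (next j) + s (next j)) + r j         ≡⟨ xy∙z≈xz∙y (a (next j)) _ _ ⟩
    (a (next j) + r j) + s (next j)         ∎)
    where open ≡-Reasoning

  fires-parallel : ∀ {O x u v} → Fires O u x → Fires O v x → Parallel u v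
  fires-parallel {O} {x} {u} {v} fu fv j = +-cancelˡ-≡ (x (next j)) _ _ (begin
    x (next j) + (u (next j) + v j)  ≡⟨ +-assoc (x (next j)) _ _ ⟨
    (x (next j) + u (next j)) + v j  ≡⟨ cong (_+ v j) (balance fu j) ⟩
    (O (next j) + u j) + v j         ≡⟨ xy∙z≈xz∙y (O (next j)) _ _ ⟩
    (O (next j) + v j) + u j         ≡⟨ cong (_+ u j) (balance fv j) ⟨
    (x (next j) + v (next j)) + u j  ≡⟨ +-assoc (x (next j)) _ _ ⟩
    x (next j) + (v (next j) + u j)  ∎)
    where open ≡-Reasoning

  fires-unique : ∀ {O x y u v} → Fires O u x → Fires O v y → u ≈ᶜ v → x ≈ᶜ y
  fires-unique {O} {x} {y} {u} {v} fu fv u≈v k with next-surjective k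
  ... | j , refl = +-cancelʳ-≡ (u (next j)) _ _ (begin
    x (next j) + u (next j)  ≡⟨ balance fu j ⟩
    O (next j) + u j         ≡⟨ cong (O (next j) +_) (u≈v j) ⟩
    O (next j) + v j         ≡⟨ balance fv j ⟨
    y (next j) + v (next j)  ≡⟨ cong (y (next j) +_) (u≈v (next j)) ⟨
    y (next j) + u (next j)  ∎)
    where open ≡-Reasoning

  fire-fires : ∀ {O i} → Allowed O i → Fires O (δ i) (fire O i)
  -- Decided by hand: a with on j ≟ i would also abstract the δ and fire redexes in the goal.
  balance (fire-fires {O} {i} al) j = by-cases (j ≟ i) (next j ≟ i)
    where
    open ≡-Reasoning
    by-cases : Dec (j ≡ i) → Dec (next j ≡ i) → fire O i (next j) + δ i (next j) ≡ O (next j) + δ i j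
    by-cases (yes j≡i) _ = subst (λ k → fire O i (next k) + δ i (next k) ≡ O (next k) + δ i k) (sym j≡i) at-self
      where
      ni≢i : next i ≢ i
      ni≢i ni≡i = <-irrefl (cong O ni≡i) al
      at-self : fire O i (next i) + δ i (next i) ≡ O (next i) + δ i i
      at-self = begin
        fire O i (next i) + δ i (next i)  ≡⟨ cong₂ _+_ (fire-next O i ni≢i) (δ-off ni≢i) ⟩
        suc (O (next i)) + 0              ≡⟨ +-identityʳ _ ⟩
        suc (O (next i))                  ≡⟨ +-comm 1 _ ⟩
        O (next i) + 1                    ≡⟨ cong (O (next i) +_) (δ-diag i) ⟨
        O (next i) + δ i i                ∎
    by-cases (no j≢i) (yes nj≡i) = begin
      fire O i (next j) + δ i (next j)  ≡⟨ cong (λ k → fire O i k + δ i k) nj≡i ⟩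
      fire O i i + δ i i                ≡⟨ cong₂ _+_ (fire-self O i) (δ-diag i) ⟩
      (O i ∸ 1) + 1                     ≡⟨ m∸n+n≡m (≤-trans (s≤s z≤n) al) ⟩
      O i                               ≡⟨ cong O nj≡i ⟨
      O (next j)                        ≡⟨ +-identityʳ _ ⟨
      O (next j) + 0                    ≡⟨ cong (O (next j) +_) (δ-off j≢i) ⟨
      O (next j) + δ i j                ∎
    by-cases (no j≢i) (no nj≢i) =
      cong₂ _+_ (fire-other O nj≢i (λ nj≡ni → j≢i (next-injective j i nj≡ni)))
                (trans (δ-off nj≢i) (sym (δ-off j≢i)))

  moves-fires : ∀ {O c} (π : Moves O c) → Fires O (shots π) c
  balance (moves-fires (done O≈c)) j = cong (_+ 0) (sym (O≈c (next j)))
  moves-fires (step i al π) =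
    fires-resp (λ k → trans (+-comm (δ i k) _) (sym (shots-step i al π k)))
               (fires-trans (fire-fires al) (moves-fires π))

  -- As long as i has not fired, player i can only have gained cards and player next i only lost some.
  fires-allowed : ∀ {O x u i} → Fires O u x → u i ≡ 0 → Allowed O i → Allowed x i
  fires-allowed {O} {x} {u} {i} fu uᵢ≡0 al with next-surjective i
  ... | j , refl = ≤-trans (s≤s x≤O) (≤-trans al O≤x)
    where
    open ≤-Reasoning
    x≤O : x (next (next j)) ≤ O (next (next j))
    x≤O = begin
      x (next (next j))                      ≤⟨ m≤m+n _ _ ⟩
      x (next (next j)) + u (next (next j))  ≡⟨ balance fu (next j) ⟩
      O (next (next j)) + u (next j)         ≡⟨ cong (O (next (next j)) +_) uᵢ≡0 ⟩
      O (next (next j)) + 0                  ≡⟨ +-identityʳ _ ⟩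
      O (next (next j))                      ∎
    O≤x : O (next j) ≤ x (next j)
    O≤x = begin
      O (next j)               ≤⟨ m≤m+n _ _ ⟩
      O (next j) + u j         ≡⟨ balance fu j ⟨
      x (next j) + u (next j)  ≡⟨ cong (x (next j) +_) uᵢ≡0 ⟩
      x (next j) + 0           ≡⟨ +-identityʳ _ ⟩
      x (next j)               ∎

  fires-fire : ∀ {O x u i} → Fires O u x → Allowed O i → Allowed x i → Fires (fire O i) u (fire x i)
  fires-fire {u = u} {i} fu al alx =
    fires-cancel (fire-fires al) (fires-resp (λ k → +-comm (u k) (δ i k)) (fires-trans fu (fire-fires alx)))

  allowed-resp : ∀ {a b : Config p} → a ≈ᶜ b → ∀ i → Allowed b i → Allowed a i
  allowed-resp a≈b i = subst₂ _<_ (sym (a≈b (next i))) (sym (a≈b i))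

  moves-respˡ : ∀ {a b c} → a ≈ᶜ b → Moves b c → Moves a c
  moves-respˡ a≈b (done b≈c) = done (λ k → trans (a≈b k) (b≈c k))
  moves-respˡ a≈b (step i al ρ) = step i (allowed-resp a≈b i al) (moves-respˡ (fire-cong a≈b i) ρ)

  shots-respˡ : ∀ {a b c} (a≈b : a ≈ᶜ b) (ρ : Moves b c) → shots (moves-respˡ a≈b ρ) ≈ᶜ shots ρ
  shots-respˡ a≈b (done _) k = refl
  shots-respˡ a≈b (step i al ρ) k = begin
    shots (moves-respˡ a≈b (step i al ρ)) k            ≡⟨ shots-step i (allowed-resp a≈b i al) _ k ⟩
    shots (moves-respˡ (fire-cong a≈b i) ρ) k + δ i k  ≡⟨ cong (_+ δ i k) (shots-respˡ (fire-cong a≈b i) ρ k) ⟩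
    shots ρ k + δ i k                                  ≡⟨ shots-step i al ρ k ⟨
    shots (step i al ρ) k                              ∎
    where open ≡-Reasoning

  moves-respʳ : ∀ {a b c} → Moves a b → b ≈ᶜ c → Moves a c
  moves-respʳ (done a≈b) b≈c = done (λ k → trans (a≈b k) (b≈c k))
  moves-respʳ (step i al ρ) b≈c = step i al (moves-respʳ ρ b≈c)

  infixr 5 _++ᵐ_
  _++ᵐ_ : ∀ {a b c} → Moves a b → Moves b c → Moves a c
  done a≈b ++ᵐ ρ = moves-respˡ a≈b ρ
  step i al σ ++ᵐ ρ = step i al (σ ++ᵐ ρ)

  shots-++ : ∀ {a b c} (σ : Moves a b) (ρ : Moves b c) → shots (σ ++ᵐ ρ) ≈ᶜ shots σ ⊕ shots ρ
  shots-++ (done a≈b) ρ = shots-respˡ a≈b ρ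
  shots-++ (step i al σ) ρ k = begin
    shots (step i al (σ ++ᵐ ρ)) k        ≡⟨ shots-step i al _ k ⟩
    shots (σ ++ᵐ ρ) k + δ i k            ≡⟨ cong (_+ δ i k) (shots-++ σ ρ k) ⟩
    (shots σ k + shots ρ k) + δ i k      ≡⟨ xy∙z≈xz∙y (shots σ k) _ _ ⟩
    (shots σ k + δ i k) + shots ρ k      ≡⟨ cong (_+ shots ρ k) (shots-step i al σ k) ⟨
    shots (step i al σ) k + shots ρ k    ∎
    where open ≡-Reasoning

  nonDual-cycle-shots : ∀ {a b} → NonDual a → a ≈ᶜ b → (ρ : Moves a b) → shots ρ ≈ᶜ (λ _ → 0)
  nonDual-cycle-shots nd a≈b (done _) k = refl
  nonDual-cycle-shots nd a≈b ρ@(step _ _ _) k = ⊥-elim (nd (moves-respʳ ρ (λ j → sym (a≈b j)) , s≤s z≤n))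

  -- Replay π from x, skipping each move of π that u still accounts for.
  remaining-moves : ∀ {O x y u} (π : Moves O y) → Fires O u x → u ≤ᶜ shots π →
                    Σ (Moves x y) λ ρ → u ⊕ shots ρ ≈ᶜ shots π
  remaining-moves {O} {x} {y} {u} (done O≈y) fu u≤0 = done x≈y , λ k → trans (+-identityʳ _) (u≈0 k)
    where
    u≈0 : u ≈ᶜ (λ _ → 0)
    u≈0 k = n≤0⇒n≡0 (u≤0 k)
    x≈y : x ≈ᶜ y
    x≈y k = trans (fires-unique fu (moves-fires (done λ _ → refl)) u≈0 k) (O≈y k)
  remaining-moves {O} {x} {y} {u} (step i al π) fu u≤ with u i ≟ℕ 0
  ... | yes uᵢ≡0 = step i alx ρ , λ k → begin
      u k + shots (step i alx ρ) k  ≡⟨ cong (u k +_) (shots-step i alx ρ k) ⟩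
      u k + (shots ρ k + δ i k)     ≡⟨ +-assoc (u k) _ _ ⟨
      u k + shots ρ k + δ i k       ≡⟨ cong (_+ δ i k) (u+ρ≈π k) ⟩
      shots π k + δ i k             ≡⟨ shots-step i al π k ⟨
      shots (step i al π) k         ∎
    where
    open ≡-Reasoning
    alx : Allowed x i
    alx = fires-allowed fu uᵢ≡0 al
    u≤π : u ≤ᶜ shots π
    u≤π = ≤-⊕δ-at-zero (λ k → subst (u k ≤_) (shots-step i al π k) (u≤ k)) uᵢ≡0
    rest : Σ (Moves (fire x i) y) λ ρ → u ⊕ shots ρ ≈ᶜ shots π
    rest = remaining-moves π (fires-fire fu al alx) u≤π
    ρ : Moves (fire x i) y
    ρ = proj₁ rest
    u+ρ≈π : u ⊕ shots ρ ≈ᶜ shots π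
    u+ρ≈π = proj₂ rest
  ... | no uᵢ≢0 = ρ , λ k → begin
      u k + shots ρ k                ≡⟨ cong (_+ shots ρ k) (⊖-⊕-inverse (δ-≤ uᵢ≢0) k) ⟨
      u⁻ k + δ i k + shots ρ k       ≡⟨ xy∙z≈xz∙y (u⁻ k) _ _ ⟩
      u⁻ k + shots ρ k + δ i k       ≡⟨ cong (_+ δ i k) (u⁻+ρ≈π k) ⟩
      shots π k + δ i k              ≡⟨ shots-step i al π k ⟨
      shots (step i al π) k          ∎
    where
    open ≡-Reasoning
    u⁻ : Fin p → ℕ
    u⁻ = u ⊖ δ i
    fu⁻ : Fires (fire O i) u⁻ x
    fu⁻ = fires-cancel (fire-fires al)
            (fires-resp (λ k → trans (sym (⊖-⊕-inverse (δ-≤ uᵢ≢0) k)) (+-comm (u⁻ k) (δ i k))) fu)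
    u⁻≤π : u⁻ ≤ᶜ shots π
    u⁻≤π = ⊖-≤-from-⊕ (λ k → subst (u k ≤_) (shots-step i al π k) (u≤ k))
    rest : Σ (Moves x y) λ ρ → u⁻ ⊕ shots ρ ≈ᶜ shots π
    rest = remaining-moves π fu⁻ u⁻≤π
    ρ : Moves x y
    ρ = proj₁ rest
    u⁻+ρ≈π : u⁻ ⊕ shots ρ ≈ᶜ shots π
    u⁻+ρ≈π = proj₂ rest

  nonDual-shots-≤⇒≈ : ∀ {O b} → NonDual b → (σ τ : Moves O b) → shots σ ≤ᶜ shots τ → shots σ ≈ᶜ shots τ
  nonDual-shots-≤⇒≈ nd σ τ σ≤τ with remaining-moves τ (moves-fires σ) σ≤τ
  ... | ρ , σ+ρ≈τ = ⊕-identityʳ-≈ σ+ρ≈τ (nonDual-cycle-shots nd (λ _ → refl) ρ)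

  nonDual-shots-unique : ∀ {O b} → NonDual b → (σ τ : Moves O b) → shots σ ≈ᶜ shots τ
  nonDual-shots-unique nd σ τ with parallel-comparable (fires-parallel (moves-fires σ) (moves-fires τ))
  ... | inj₁ σ≤τ = nonDual-shots-≤⇒≈ nd σ τ σ≤τ
  ... | inj₂ τ≤σ = λ k → sym (nonDual-shots-≤⇒≈ nd τ σ τ≤σ k)

theorem3 : (p n : ℕ) .{{_ : NonZero p}} (O : Config p) → total O ≡ n →
           (a b : Config p) (σ : Moves O a) (τ : Moves O b) →
           NonDual a → NonDual b →
           (Reachable a b × ¬ (a ≈ᶜ b)) ⇔ (shots σ <ᶜ shots τ)
theorem3 p n O _ a b σ τ nda ndb = mk⇔ to from
  where
  to : Reachable a b × ¬ (a ≈ᶜ b) → shots σ <ᶜ shots τ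
  to (ρ , a≉b) = σ≤τ , λ σ≈τ → a≉b (fires-unique (moves-fires σ) (moves-fires τ) σ≈τ)
    where
    σ≤τ : shots σ ≤ᶜ shots τ
    σ≤τ k = subst (shots σ k ≤_) (trans (sym (shots-++ σ ρ k)) (nonDual-shots-unique ndb (σ ++ᵐ ρ) τ k))
                  (m≤m+n _ _)
  from : shots σ <ᶜ shots τ → Reachable a b × ¬ (a ≈ᶜ b)
  from (σ≤τ , σ≉τ) with remaining-moves τ (moves-fires σ) σ≤τ
  ... | ρ , σ+ρ≈τ = ρ , λ a≈b → σ≉τ (⊕-identityʳ-≈ σ+ρ≈τ (nonDual-cycle-shots nda a≈b ρ))
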